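{- Let $h:G\to P$ be a skew fibration into a combinatorial proposition $P$. If $h(G)$ is true then $P$ is true.
   Context: A graph $(V,E)$: finite $V$, $E$ a set of two-element subsets of $V$; write $vw$. A homomorphism $h:G\to G'$ satisfies $vw\in E(G)\Rightarrow h(v)h(w)\in E(G')$; it is a skew fibration if for every $v\in V(G)$ and every $w$ with $h(v)w\in E(G')$ there is $\hat w$ with $v\hat w\in E(G)$ and $h(\hat w)w\notin E(G')$. A cograph is a graph with nonempty vertex set such that for any distinct $v,w,x,y$ the edges among $\{v,w,x,y\}$ are not exactly $\{vw,wx,xy\}$. Atoms are literals $p,\overline p$ (variables $p$) and constants $0,1$; $p,\overline p$ are dual. A combinatorial proposition is a cograph with an atom (label) attached to each vertex. $h(G)$ is the induced subgraph of $P$ on $h(V(G))$ with inherited labels. A stable set contains no edge; a clause is a maximal stable set; a clause is true if it contains a $1$-labelled vertex or two vertices labelled by dual literals; a labelled graph is true if all its clauses are true. -}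

module Defs where

open import Data.Nat using (ℕ)
open import Data.Bool using (Bool; true; false)
open import Data.Fin using (Fin)
open import Data.Fin.Subset using (Subset; _∈_; _∉_; _⊆_)
open import Data.Product using (Σ; ∃; _×_; _,_)
open import Data.Sum using (_⊎_)
open import Relation.Binary.PropositionalEquality using (_≡_; _≢_)
open import Relation.Nullary using (¬_)

record Graph : Set where
  field
    n     : ℕ
    adj   : Fin n → Fin n → Bool
    irrefl : ∀ v → adj v v ≡ false
    sym    : ∀ v w → adj v w ≡ adj w v
open Graph public

Edge : (G : Graph) → Fin (n G) → Fin (n G) → Set
Edge G v w = adj G v w ≡ true

-- Cograph: nonempty vertex set, and no induced P4.
-- For distinct v w x y, the edge set among them is not exactly {vw, wx, xy}.
IsCograph : Graph → Set
IsCograph G =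
  Fin (n G) ×
  (∀ v w x y → v ≢ w → v ≢ x → v ≢ y → w ≢ x → w ≢ y → x ≢ y →
     ¬ (Edge G v w × Edge G w x × Edge G x y ×
        ¬ Edge G v x × ¬ Edge G v y × ¬ Edge G w y))

data Atom : Set where
  pos  : ℕ → Atom
  neg  : ℕ → Atom
  zero : Atom
  one  : Atom

data Dual : Atom → Atom → Set where
  pos-neg : ∀ p → Dual (pos p) (neg p)
  neg-pos : ∀ p → Dual (neg p) (pos p)

record CombProp : Set where
  field
    graph   : Graph
    cograph : IsCograph graph
    label   : Fin (n graph) → Atom
open CombProp public

IsHom : (G H : Graph) → (Fin (n G) → Fin (n H)) → Set
IsHom G H h = ∀ v w → Edge G v w → Edge H (h v) (h w)

IsSkewFibration : (G H : Graph) → (Fin (n G) → Fin (n H)) → Set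
IsSkewFibration G H h =
  IsHom G H h ×
  (∀ v w → Edge H (h v) w → ∃ λ ŵ → Edge G v ŵ × ¬ Edge H (h ŵ) w)

-- Labelled graph induced on a vertex subset U of a labelled graph
-- (G, ℓ).  Its stable sets / clauses are subsets of U.
module _ (G : Graph) (ℓ : Fin (n G) → Atom) (U : Subset (n G)) where

  StableIn : Subset (n G) → Set
  StableIn S = S ⊆ U × (∀ v w → v ∈ S → w ∈ S → ¬ Edge G v w)

  ClauseIn : Subset (n G) → Set
  ClauseIn S = StableIn S × (∀ T → StableIn T → S ⊆ T → T ⊆ S)

  TrueSet : Subset (n G) → Set
  TrueSet S =
    (∃ λ v → v ∈ S × ℓ v ≡ one) ⊎
    (∃ λ v → ∃ λ w → v ∈ S × w ∈ S × Dual (ℓ v) (ℓ w))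

  TrueOn : Set
  TrueOn = ∀ S → ClauseIn S → TrueSet S

Image : {k m : ℕ} → (Fin k → Fin m) → Subset m
Image {k} {m} h = Data.Vec.tabulate (λ v → Relation.Nullary.Decidable.⌊ Data.Fin.Properties.any? (λ u → h u Data.Fin.≟ v) ⌋)
  where
  import Data.Vec
  import Relation.Nullary.Decidable
  import Data.Fin.Properties
  import Data.Fin

IsTrue : CombProp → Set
IsTrue P = TrueOn (graph P) (label P) Data.Fin.Subset.⊤

ImageTrue : (G : Graph) (P : CombProp) → (Fin (n G) → Fin (n (graph P))) → Set
ImageTrue G P h = TrueOn (graph P) (label P) (Image h)

-- Let S be a clause of P.  Its trace S ∩ h(V(G)) is stable, and it is a clause of
-- h(G): every vertex u = h v of h(G) outside S has a neighbour in S ∩ h(V(G)).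
-- Indeed, maximality of S gives a neighbour s ∈ S of u, and the skew fibration gives
-- an edge v ŵ of G with x = h ŵ not adjacent to s.  If x ∉ S, the path s–u–x–t
-- cannot be an induced P4 for any S-neighbour t of x, so the S-neighbours of x are
-- S-neighbours of u, and there are strictly fewer of them (s is missing); recurse on x.
-- Truth of the clause S ∩ h(V(G)) of h(G) then makes S true.
module Submission where

open import Defs
open import Data.Bool using (Bool; true)
open import Data.Bool.Properties using (T-≡)
import Data.Bool as Bool
open import Data.Empty using (⊥-elim)
open import Data.Fin using (Fin)
open import Data.Fin.Properties using (any?)
open import Data.Fin.Subset using (Subset; _∈_; _∉_; _⊆_; _⊂_; _∩_; _∪_; ⁅_⁆; ⊤; ∣_∣)
open import Data.Fin.Subset.Properties
  using (_∈?_; ∈⊤; x∈⁅x⁆; x∈⁅y⁆⇒x≡y; p⊆p∪q; q⊆p∪q; x∈p∪q⁻; x∈p∩q⁺; x∈p∩q⁻; p∩q⊆p; p⊂q⇒∣p∣<∣q∣)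
open import Data.Nat using (_<_)
open import Data.Nat.Induction using (<-wellFounded)
open import Data.Product using (∃; _×_; _,_; proj₁; proj₂)
open import Data.Sum using (_⊎_; inj₁; inj₂)
open import Data.Vec using (tabulate)
open import Data.Vec.Properties using (lookup∘tabulate; lookup⇒[]=; []=⇒lookup)
open import Function using (_on_; _∘_)
open import Function.Bundles using (Equivalence)
open import Induction.WellFounded using (Acc; acc)
import Relation.Binary.Construct.On as On
open import Relation.Binary.PropositionalEquality using (_≡_; _≢_; refl; trans)
import Relation.Binary.PropositionalEquality as ≡
open import Relation.Nullary using (¬_; Dec; yes; no)
open import Relation.Nullary.Decidable using (_×-dec_; decidable-stable; fromWitness; toWitness)

∈-tabulate⁺ : ∀ {m} {f : Fin m → Bool} {t} → f t ≡ true → t ∈ tabulate f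
∈-tabulate⁺ {f = f} {t} ft = lookup⇒[]= t (tabulate f) (trans (lookup∘tabulate f t) ft)

∈-tabulate⁻ : ∀ {m} {f : Fin m → Bool} {t} → t ∈ tabulate f → f t ≡ true
∈-tabulate⁻ {f = f} {t} t∈ = trans (≡.sym (lookup∘tabulate f t)) ([]=⇒lookup t∈)

module _ {k m} (h : Fin k → Fin m) where

  ∈-Image⁺ : ∀ u → h u ∈ Image h
  ∈-Image⁺ u = ∈-tabulate⁺ (Equivalence.to T-≡ (fromWitness (u , refl)))

  ∈-Image⁻ : ∀ {t} → t ∈ Image h → ∃ λ u → h u ≡ t
  ∈-Image⁻ t∈ = toWitness (Equivalence.from T-≡ (∈-tabulate⁻ t∈))

Edge? : (G : Graph) → ∀ v w → Dec (Edge G v w)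
Edge? G v w = adj G v w Bool.≟ true

Edge-sym : (G : Graph) → ∀ {v w} → Edge G v w → Edge G w v
Edge-sym G {v} {w} vw = trans (sym G w v) vw

Edge⇒≢ : (G : Graph) → ∀ {v w} → Edge G v w → v ≢ w
Edge⇒≢ G {v} vv refl with trans (≡.sym vv) (irrefl G v)
... | ()

neighbourhood : (G : Graph) → Fin (n G) → Subset (n G)
neighbourhood G u = tabulate (adj G u)

module _ (G : Graph) (ℓ : Fin (n G) → Atom) where

  clause-dominating : ∀ {U S u} → ClauseIn G ℓ U S → u ∈ U → u ∉ S →
                      ∃ λ s → s ∈ S × Edge G u s
  clause-dominating {U} {S} {u} ((S⊆U , S-stable) , S-maximal) u∈U u∉S
    with any? (λ s → (s ∈? S) ×-dec Edge? G u s)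
  ... | yes dominated = dominated
  ... | no ¬dominated =
    ⊥-elim (u∉S (S-maximal (S ∪ ⁅ u ⁆) extension-stable (p⊆p∪q _) (q⊆p∪q S _ (x∈⁅x⁆ u))))
    where
    in-extension : ∀ {v} → v ∈ S ∪ ⁅ u ⁆ → v ∈ S ⊎ v ≡ u
    in-extension {v} v∈ with x∈p∪q⁻ S ⁅ u ⁆ v∈
    ... | inj₁ v∈S = inj₁ v∈S
    ... | inj₂ v∈u = inj₂ (x∈⁅y⁆⇒x≡y u v∈u)

    extension-stable : StableIn G ℓ U (S ∪ ⁅ u ⁆)
    extension-stable = ⊆U , λ v w v∈ w∈ → no-edge (in-extension v∈) (in-extension w∈)
      where
      ⊆U : S ∪ ⁅ u ⁆ ⊆ U
      ⊆U v∈ with in-extension v∈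
      ... | inj₁ v∈S = S⊆U v∈S
      ... | inj₂ refl = u∈U

      no-edge : ∀ {v w} → v ∈ S ⊎ v ≡ u → w ∈ S ⊎ w ≡ u → ¬ Edge G v w
      no-edge (inj₁ v∈S) (inj₁ w∈S) = S-stable _ _ v∈S w∈S
      no-edge (inj₁ v∈S) (inj₂ refl) = λ vu → ¬dominated (_ , v∈S , Edge-sym G vu)
      no-edge (inj₂ refl) (inj₁ w∈S) = λ uw → ¬dominated (_ , w∈S , uw)
      no-edge (inj₂ refl) (inj₂ refl) = λ uu → Edge⇒≢ G uu refl

  clause-∩ : ∀ {U S} → StableIn G ℓ ⊤ S →
             (∀ {t} → t ∈ U → t ∉ S → ∃ λ c → c ∈ S ∩ U × Edge G t c) →
             ClauseIn G ℓ U (S ∩ U)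
  clause-∩ {U} {S} (_ , S-stable) dominated =
    (p∩q⊆q , λ v w v∈ w∈ → S-stable v w (p∩q⊆p S U v∈) (p∩q⊆p S U w∈)) , maximal
    where
    p∩q⊆q : S ∩ U ⊆ U
    p∩q⊆q = proj₂ ∘ x∈p∩q⁻ S U

    maximal : ∀ T → StableIn G ℓ U T → S ∩ U ⊆ T → T ⊆ S ∩ U
    maximal T (T⊆U , T-stable) S∩U⊆T {t} t∈T with t ∈? S
    ... | yes t∈S = x∈p∩q⁺ (t∈S , T⊆U t∈T)
    ... | no t∉S with dominated (T⊆U t∈T) t∉S
    ... | c , c∈ , tc = ⊥-elim (T-stable t c t∈T (S∩U⊆T c∈) tc)

  -- TrueSet ignores its vertex-set argument, so ⊤ here also covers TrueSet on Image h.
  TrueSet-mono : ∀ {S T} → S ⊆ T → TrueSet G ℓ ⊤ S → TrueSet G ℓ ⊤ T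
  TrueSet-mono S⊆T (inj₁ (v , v∈ , v-one)) = inj₁ (v , S⊆T v∈ , v-one)
  TrueSet-mono S⊆T (inj₂ (v , w , v∈ , w∈ , dual)) = inj₂ (v , w , S⊆T v∈ , S⊆T w∈ , dual)

cograph-path-chord : (G : Graph) → IsCograph G → ∀ {s u x t} → s ≢ x → u ≢ t →
                     Edge G s u → Edge G u x → Edge G x t →
                     ¬ Edge G s x → ¬ Edge G s t → Edge G u t
cograph-path-chord G (_ , no-P4) {s} {u} {x} {t} s≢x u≢t su ux xt ¬sx ¬st =
  decidable-stable (Edge? G u t) λ ¬ut →
    no-P4 s u x t (Edge⇒≢ G su) s≢x s≢t (Edge⇒≢ G ux) u≢t (Edge⇒≢ G xt)
          (su , ux , xt , ¬sx , ¬st , ¬ut)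
  where
  s≢t : s ≢ t
  s≢t refl = ¬sx (Edge-sym G xt)

module _ (H : Graph) (cograph : IsCograph H) {S : Subset (n H)}
         (S-stable : ∀ v w → v ∈ S → w ∈ S → ¬ Edge H v w)
         {u x s} (u∉S : u ∉ S) (x∉S : x ∉ S) (ux : Edge H u x)
         (s∈S : s ∈ S) (us : Edge H u s) (¬xs : ¬ Edge H x s) where

  S-neighbour-inherited : ∀ {t} → t ∈ S → Edge H x t → Edge H u t
  S-neighbour-inherited t∈S xt =
    cograph-path-chord H cograph (λ { refl → x∉S s∈S }) (λ { refl → u∉S t∈S })
      (Edge-sym H us) ux xt (¬xs ∘ Edge-sym H) (S-stable _ _ s∈S t∈S)

  S-neighbourhood-shrinks : S ∩ neighbourhood H x ⊂ S ∩ neighbourhood H u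
  S-neighbourhood-shrinks =
    inherited , s , x∈p∩q⁺ (s∈S , ∈-tabulate⁺ us) , ¬xs ∘ ∈-tabulate⁻ ∘ proj₂ ∘ x∈p∩q⁻ S _
    where
    inherited : S ∩ neighbourhood H x ⊆ S ∩ neighbourhood H u
    inherited t∈ with x∈p∩q⁻ S _ t∈
    ... | t∈S , xt = x∈p∩q⁺ (t∈S , ∈-tabulate⁺ (S-neighbour-inherited t∈S (∈-tabulate⁻ xt)))

module _ (G H : Graph) (ℓ : Fin (n H) → Atom) (h : Fin (n G) → Fin (n H))
         (skew : IsSkewFibration G H h) (cograph : IsCograph H)
         {S : Subset (n H)} (S-clause : ClauseIn H ℓ ⊤ S) where

  private
    S-stable : ∀ v w → v ∈ S → w ∈ S → ¬ Edge H v w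
    S-stable = proj₂ (proj₁ S-clause)

    _⊏_ : Fin (n H) → Fin (n H) → Set
    _⊏_ = _<_ on λ u → ∣ S ∩ neighbourhood H u ∣

    dominated : ∀ v → Acc _⊏_ (h v) → h v ∉ S → ∃ λ c → c ∈ S ∩ Image h × Edge H (h v) c
    dominated v (acc smaller) hv∉S with clause-dominating H ℓ S-clause ∈⊤ hv∉S
    ... | s , s∈S , hv-s with proj₂ skew v s hv-s
    ... | ŵ , vŵ , ¬hŵ-s with h ŵ ∈? S
    ... | yes hŵ∈S = h ŵ , x∈p∩q⁺ (hŵ∈S , ∈-Image⁺ h ŵ) , proj₁ skew v ŵ vŵ
    ... | no hŵ∉S with dominated ŵ (smaller (p⊂q⇒∣p∣<∣q∣ (S-neighbourhood-shrinks
                         H cograph S-stable hv∉S hŵ∉S (proj₁ skew v ŵ vŵ) s∈S hv-s ¬hŵ-s))) hŵ∉S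
    ... | c , c∈ , hŵ-c = c , c∈ , S-neighbour-inherited
            H cograph S-stable hv∉S hŵ∉S (proj₁ skew v ŵ vŵ) s∈S hv-s ¬hŵ-s (p∩q⊆p S _ c∈) hŵ-c

  image-dominated : ∀ {u} → u ∈ Image h → u ∉ S → ∃ λ c → c ∈ S ∩ Image h × Edge H u c
  image-dominated u∈ u∉S with ∈-Image⁻ h u∈
  ... | v , refl = dominated v (On.wellFounded _ <-wellFounded (h v)) u∉S

lemma5 : (G : Graph) (P : CombProp) (h : Fin (n G) → Fin (n (graph P))) →
         IsSkewFibration G (graph P) h → ImageTrue G P h → IsTrue P
lemma5 G P h skew image-true S S-clause =
  TrueSet-mono (graph P) (label P) (p∩q⊆p S (Image h))
    (image-true (S ∩ Image h)
      (clause-∩ (graph P) (label P) (proj₁ S-clause)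
        (image-dominated G (graph P) (label P) h skew (cograph P) S-clause)))
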